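{- Let $n\ge1$, let $S\ge 2$ be an integer and let $p(0),\dots,p(n)$ be a probability distribution on $\{0,\dots,n\}$. Then $$\mathrm{val}(L^*(n,S),p)\ \ge\ \sum_i p(i)(s(i)-i)\ -\ S\max_j \sum_{i:\ i\le j<s(i)}\frac{(j)_i}{(n)_i}\,p(i)\,(s(i)-j).$$
   Context: The linear program $L^*(n,S)$ (depending on $p$) has variables $v\ge 0$, $v_i\ge0$ ($0\le i\le n$), $v_{i,j}\ge 0$ ($0\le i\le j\le n$), subject to: for each $j$, $\sum_{i\le j}v_{i,j}-\binom{n}{j}v\le 0$; and for each $i\le j$, $\binom{n-i}{j-i}v_i-v_{i,j}\le p(i)\binom{n-i}{j-i}(j-i)$. Its value $\mathrm{val}(L^*(n,S),p)$ is the maximum of $\sum_i v_i - Sv$ over feasible solutions. For integers $s\ge0$, $(s)_i=s(s-1)\cdots(s-i+1)$ is the falling factorial, and $s(i)=\min\{s\in\mathbb{Z}_{\ge0}: (s)_i>(n)_i/S\}$. Indices $i,j$ range over $\{0,\dots,n\}$. (In the paper $S=2^v$ where $v$ is the number of pools.)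
   Formalization: The probability distribution p(0),…,p(n) takes rational values. -}

module Defs where

open import Data.Nat as ℕ using (ℕ; zero; suc; _∸_; _<ᵇ_)
open import Data.Nat.Combinatorics using (_C_)
open import Data.Bool using (if_then_else_)
open import Relation.Nullary using (yes; no)
open import Data.Integer using (+_)
open import Data.Rational as ℚ using (ℚ; _/_; 0ℚ; _+_; _-_; _*_; _≤_; _⊔_)
open import Data.Product using (Σ; _×_; _,_)
open import Relation.Binary.PropositionalEquality using (_≡_)

⟦_⟧ : ℕ → ℚ
⟦ k ⟧ = + k / 1

-- a / b as a rational, with the (never used here) convention a / 0 = 0
ratio : ℕ → ℕ → ℚ
ratio a zero    = 0ℚ
ratio a (suc b) = + a / suc b

ff : ℕ → ℕ → ℕ
ff s zero    = 1
ff s (suc i) = s ℕ.* ff (s ∸ 1) i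

sumTo : ℕ → (ℕ → ℚ) → ℚ
sumTo zero    f = f 0
sumTo (suc n) f = sumTo n f + f (suc n)

maxTo : ℕ → (ℕ → ℚ) → ℚ
maxTo zero    f = f 0
maxTo (suc n) f = maxTo n f ⊔ f (suc n)

-- s(i) = min { s ∈ ℕ : (s)_i > (n)_i / S }, i.e. least s with (n)_i < S * (s)_i.
-- Computed by upward search from 0; the fuel n+1 suffices since s = n
-- satisfies the condition for i ≤ n, n ≥ 1, S ≥ 2.
sSearch : (n S i start fuel : ℕ) → ℕ
sSearch n S i s zero        = s
sSearch n S i s (suc fuel) =
  if ff n i <ᵇ S ℕ.* ff s i then s else sSearch n S i (suc s) fuel

sOf : (n S i : ℕ) → ℕ
sOf n S i = sSearch n S i 0 (suc n)

-- Feasibility for the linear program L*(n,S) with parameter p.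
-- Variables: v, v_i (0 ≤ i ≤ n), v_{i,j} (0 ≤ i ≤ j ≤ n); values at
-- other indices are irrelevant.
Feasible : (n S : ℕ) (p : ℕ → ℚ) (v : ℚ) (vi : ℕ → ℚ) (vij : ℕ → ℕ → ℚ) → Set
Feasible n S p v vi vij =
    (0ℚ ≤ v)
  × (∀ i → i ℕ.≤ n → 0ℚ ≤ vi i)
  × (∀ i j → i ℕ.≤ j → j ℕ.≤ n → 0ℚ ≤ vij i j)
  × (∀ j → j ℕ.≤ n →
       sumTo j (λ i → vij i j) - ⟦ n C j ⟧ * v ≤ 0ℚ)
  × (∀ i j → i ℕ.≤ j → j ℕ.≤ n →
       ⟦ (n ∸ i) C (j ∸ i) ⟧ * vi i - vij i j
         ≤ p i * ⟦ (n ∸ i) C (j ∸ i) ⟧ * ⟦ j ∸ i ⟧)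

objective : (n S : ℕ) (v : ℚ) (vi : ℕ → ℚ) → ℚ
objective n S v vi = sumTo n vi - ⟦ S ⟧ * v

-- val(L*(n,S),p) ≥ x  :⟺  some feasible solution has objective ≥ x
-- (the LP maximum is attained when finite, and is rational for rational data)
ValGeq : (n S : ℕ) (p : ℕ → ℚ) (x : ℚ) → Set
ValGeq n S p x =
  Σ ℚ λ v → Σ (ℕ → ℚ) λ vi → Σ (ℕ → ℕ → ℚ) λ vij →
    Feasible n S p v vi vij × (x ≤ objective n S v vi)

IsProbDist : ℕ → (ℕ → ℚ) → Set
IsProbDist n p = (∀ i → i ℕ.≤ n → 0ℚ ≤ p i) × (sumTo n p ≡ ℚ.1ℚ)


termIJ : (n S : ℕ) (p : ℕ → ℚ) (i j : ℕ) → ℚ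
termIJ n S p i j with i ℕ.≤? j | j ℕ.<? sOf n S i
... | yes _ | yes _ = ratio (ff j i) (ff n i) * p i * (⟦ sOf n S i ⟧ - ⟦ j ⟧)
... | _     | _     = 0ℚ

{-# OPTIONS --safe #-}
module Submission where

open import Defs
open import Data.Nat as ℕ using (ℕ; zero; suc; _≤_; _<_; z≤n; s≤s)
open import Data.Rational using (ℚ; _*_; _-_)

open import Data.Bool using (T; true; false)
open import Data.Integer as ℤ using (+_)
import Data.Integer.Properties as ℤ
open import Data.Nat.Combinatorics using (_C_; nCk+nC[k+1]≡[n+1]C[k+1]; nC1≡n; k>n⇒nCk≡0)
import Data.Nat.Properties as ℕ
open import Data.Product using (_,_)
open import Data.Rational as ℚ using (0ℚ; _+_; -_)
import Data.Rational.Properties as ℚ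
open import Data.Rational.Solver using (module +-*-Solver)
import Data.Rational.Unnormalised as ℚᵘ
import Data.Rational.Unnormalised.Properties as ℚᵘ
open import Data.Sum using (inj₁; inj₂; [_,_]′)
open import Relation.Nullary using (yes; no; contradiction)
open import Relation.Binary.PropositionalEquality

-- The bound is the objective value of an explicit feasible point. With t(i,j) the summand
-- of the bound, take v = max_j Σ_i t(i,j), v_i = p(i)(s(i) − i) and v_{i,j} = C(n,j) t(i,j).
-- The constraints indexed by j hold because t ≥ 0, so Σ_{i≤j} t(i,j) ≤ Σ_i t(i,j) ≤ v.
-- For the constraints indexed by (i,j), the identity C(n,j)(j)_i = (n)_i C(n−i,j−i) turns
-- v_{i,j} into C(n−i,j−i) p(i)(s(i) − j) when j < s(i), which gives equality; when
-- j ≥ s(i) we have v_{i,j} = 0 and s(i) − i ≤ j − i.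

s<i⇒ff[s,i]≡0 : ∀ {s i} → s < i → ff s i ≡ 0
s<i⇒ff[s,i]≡0 {zero}  {suc i} _         = refl
s<i⇒ff[s,i]≡0 {suc s} {suc i} (s≤s s<i) =
  trans (cong (suc s ℕ.*_) (s<i⇒ff[s,i]≡0 s<i)) (ℕ.*-zeroʳ (suc s))

i≤s⇒0<ff[s,i] : ∀ {s i} → i ≤ s → 0 < ff s i
i≤s⇒0<ff[s,i] {s}     {zero}  _         = s≤s z≤n
i≤s⇒0<ff[s,i] {suc s} {suc i} (s≤s i≤s) = ℕ.*-mono-< {0} {suc s} ℕ.z<s (i≤s⇒0<ff[s,i] i≤s)

[1+m]C[1+k]*[1+k]≡[1+m]*mCk : ∀ m k → (suc m C suc k) ℕ.* suc k ≡ suc m ℕ.* (m C k)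
[1+m]C[1+k]*[1+k]≡[1+m]*mCk m       zero    =
  cong (ℕ._* 1) (nC1≡n (suc m))
[1+m]C[1+k]*[1+k]≡[1+m]*mCk zero    (suc k) =
  cong (ℕ._* suc (suc k)) (k>n⇒nCk≡0 {1} {suc (suc k)} (s≤s (s≤s z≤n)))
[1+m]C[1+k]*[1+k]≡[1+m]*mCk (suc m) (suc k) = begin
  (suc (suc m) C suc k′) ℕ.* suc k′                  ≡⟨ cong (ℕ._* suc k′) (nCk+nC[k+1]≡[n+1]C[k+1] (suc m) k′) ⟨
  (A ℕ.+ B) ℕ.* suc k′                               ≡⟨ ℕ.*-distribʳ-+ (suc k′) A B ⟩
  A ℕ.* suc k′ ℕ.+ B ℕ.* suc k′                      ≡⟨ cong (ℕ._+ B ℕ.* suc k′) (ℕ.*-suc A k′) ⟩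
  A ℕ.+ A ℕ.* k′ ℕ.+ B ℕ.* suc k′                    ≡⟨ cong₂ (λ x y → A ℕ.+ x ℕ.+ y)
                                                          ([1+m]C[1+k]*[1+k]≡[1+m]*mCk m k)
                                                          ([1+m]C[1+k]*[1+k]≡[1+m]*mCk m k′) ⟩
  A ℕ.+ suc m ℕ.* (m C k) ℕ.+ suc m ℕ.* (m C k′)     ≡⟨ ℕ.+-assoc A _ _ ⟩
  A ℕ.+ (suc m ℕ.* (m C k) ℕ.+ suc m ℕ.* (m C k′))   ≡⟨ cong (A ℕ.+_) (ℕ.*-distribˡ-+ (suc m) (m C k) (m C k′)) ⟨
  A ℕ.+ suc m ℕ.* (m C k ℕ.+ m C k′)                 ≡⟨ cong (λ x → A ℕ.+ suc m ℕ.* x) (nCk+nC[k+1]≡[n+1]C[k+1] m k) ⟩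
  suc (suc m) ℕ.* A                                  ∎
  where
  open ≡-Reasoning
  k′ = suc k
  A  = suc m C suc k
  B  = suc m C suc k′

nCj*ff[j,i]≡ff[n,i]*[n∸i]C[j∸i] : ∀ {n j i} → i ≤ j → j ≤ n →
  (n C j) ℕ.* ff j i ≡ ff n i ℕ.* ((n ℕ.∸ i) C (j ℕ.∸ i))
nCj*ff[j,i]≡ff[n,i]*[n∸i]C[j∸i] {n} {j} {zero} _ _ =
  trans (ℕ.*-identityʳ (n C j)) (sym (ℕ.+-identityʳ (n C j)))
nCj*ff[j,i]≡ff[n,i]*[n∸i]C[j∸i] {suc n} {suc j} {suc i} (s≤s i≤j) (s≤s j≤n) = begin
  (suc n C suc j) ℕ.* (suc j ℕ.* ff j i)         ≡⟨ ℕ.*-assoc (suc n C suc j) (suc j) (ff j i) ⟨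
  (suc n C suc j) ℕ.* suc j ℕ.* ff j i           ≡⟨ cong (ℕ._* ff j i) ([1+m]C[1+k]*[1+k]≡[1+m]*mCk n j) ⟩
  suc n ℕ.* (n C j) ℕ.* ff j i                   ≡⟨ ℕ.*-assoc (suc n) (n C j) (ff j i) ⟩
  suc n ℕ.* ((n C j) ℕ.* ff j i)                 ≡⟨ cong (suc n ℕ.*_) (nCj*ff[j,i]≡ff[n,i]*[n∸i]C[j∸i] i≤j j≤n) ⟩
  suc n ℕ.* (ff n i ℕ.* ((n ℕ.∸ i) C (j ℕ.∸ i))) ≡⟨ ℕ.*-assoc (suc n) (ff n i) _ ⟨
  suc n ℕ.* ff n i ℕ.* ((n ℕ.∸ i) C (j ℕ.∸ i))   ∎
  where open ≡-Reasoning

m<S*ff[s,i]⇒i≤s : ∀ {m S s i} → m < S ℕ.* ff s i → i ≤ s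
m<S*ff[s,i]⇒i≤s {m} {S} {s} {i} m<S*ff with i ℕ.≤? s
... | yes i≤s = i≤s
... | no  i≰s = contradiction (subst (m <_) S*ff≡0 m<S*ff) ℕ.n≮0
  where
  S*ff≡0 : S ℕ.* ff s i ≡ 0
  S*ff≡0 = trans (cong (S ℕ.*_) (s<i⇒ff[s,i]≡0 (ℕ.≰⇒> i≰s))) (ℕ.*-zeroʳ S)

i≤sSearch : ∀ n S i s fuel → i ≤ s ℕ.+ fuel → i ≤ sSearch n S i s fuel
i≤sSearch n S i s zero       i≤s+0 = subst (i ≤_) (ℕ.+-identityʳ s) i≤s+0
i≤sSearch n S i s (suc fuel) i≤s+1+fuel with ff n i ℕ.<ᵇ S ℕ.* ff s i in found
... | true  = m<S*ff[s,i]⇒i≤s {S = S} (ℕ.<ᵇ⇒< (ff n i) (S ℕ.* ff s i) (subst T (sym found) _))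
... | false = i≤sSearch n S i (suc s) fuel (subst (i ≤_) (ℕ.+-suc s fuel) i≤s+1+fuel)

i≤sOf : ∀ n S {i} → i ≤ n → i ≤ sOf n S i
i≤sOf n S {i} i≤n = i≤sSearch n S i 0 (suc n) (ℕ.m≤n⇒m≤1+n i≤n)

p≤p+q : ∀ p {q} → 0ℚ ℚ.≤ q → p ℚ.≤ p + q
p≤p+q p {q} 0≤q = subst (ℚ._≤ p + q) (ℚ.+-identityʳ p) (ℚ.+-monoʳ-≤ p 0≤q)

p≤q⇒p-q≤0 : ∀ {p q} → p ℚ.≤ q → p - q ℚ.≤ 0ℚ
p≤q⇒p-q≤0 {p} {q} p≤q = subst (p - q ℚ.≤_) (ℚ.+-inverseʳ q) (ℚ.+-monoˡ-≤ (- q) p≤q)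

*-nonNeg : ∀ {p q} → 0ℚ ℚ.≤ p → 0ℚ ℚ.≤ q → 0ℚ ℚ.≤ p * q
*-nonNeg {p} {q} 0≤p 0≤q = ℚ.nonNegative⁻¹ (p * q)
  {{ℚ.nonNeg*nonNeg⇒nonNeg p {{ℚ.nonNegative 0≤p}} q {{ℚ.nonNegative 0≤q}}}}

⟦⟧-nonNeg : ∀ k → 0ℚ ℚ.≤ ⟦ k ⟧
⟦⟧-nonNeg k = ℚ.nonNegative⁻¹ ⟦ k ⟧ {{ℚ.normalize-nonNeg k 1}}

toℚᵘ-⟦⟧ : ∀ k → ℚ.toℚᵘ ⟦ k ⟧ ℚᵘ.≃ ℚᵘ.mkℚᵘ (+ k) 0
toℚᵘ-⟦⟧ k = ℚ.toℚᵘ-fromℚᵘ (ℚᵘ.mkℚᵘ (+ k) 0)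

[a+b]/1≃a/1+b/1 : ∀ a b → ℚᵘ.mkℚᵘ (+ (a ℕ.+ b)) 0 ℚᵘ.≃ ℚᵘ.mkℚᵘ (+ a) 0 ℚᵘ.+ ℚᵘ.mkℚᵘ (+ b) 0
[a+b]/1≃a/1+b/1 a b = ℚᵘ.*≡* (begin
  + (a ℕ.+ b) ℤ.* + 1                    ≡⟨ ℤ.*-identityʳ _ ⟩
  + (a ℕ.+ b)                            ≡⟨ ℤ.pos-+ a b ⟩
  + a ℤ.+ + b                            ≡⟨ cong₂ ℤ._+_ (ℤ.*-identityʳ (+ a)) (ℤ.*-identityʳ (+ b)) ⟨
  + a ℤ.* + 1 ℤ.+ + b ℤ.* + 1            ≡⟨ ℤ.*-identityʳ _ ⟨
  (+ a ℤ.* + 1 ℤ.+ + b ℤ.* + 1) ℤ.* + 1  ∎)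
  where open ≡-Reasoning

⟦⟧-homo-+ : ∀ a b → ⟦ a ℕ.+ b ⟧ ≡ ⟦ a ⟧ + ⟦ b ⟧
⟦⟧-homo-+ a b = ℚ.toℚᵘ-injective (begin
  ℚ.toℚᵘ ⟦ a ℕ.+ b ⟧                      ≈⟨ toℚᵘ-⟦⟧ (a ℕ.+ b) ⟩
  ℚᵘ.mkℚᵘ (+ (a ℕ.+ b)) 0                 ≈⟨ [a+b]/1≃a/1+b/1 a b ⟩
  ℚᵘ.mkℚᵘ (+ a) 0 ℚᵘ.+ ℚᵘ.mkℚᵘ (+ b) 0    ≈⟨ ℚᵘ.+-cong (toℚᵘ-⟦⟧ a) (toℚᵘ-⟦⟧ b) ⟨
  ℚ.toℚᵘ ⟦ a ⟧ ℚᵘ.+ ℚ.toℚᵘ ⟦ b ⟧          ≈⟨ ℚ.toℚᵘ-homo-+ ⟦ a ⟧ ⟦ b ⟧ ⟨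
  ℚ.toℚᵘ (⟦ a ⟧ + ⟦ b ⟧)                  ∎)
  where open ℚᵘ.≃-Reasoning

⟦⟧-homo-∸ : ∀ {a b} → a ≤ b → ⟦ b ℕ.∸ a ⟧ ≡ ⟦ b ⟧ - ⟦ a ⟧
⟦⟧-homo-∸ {a} {b} a≤b = begin
  ⟦ b ℕ.∸ a ⟧                      ≡⟨ x≡x+y-y ⟦ b ℕ.∸ a ⟧ ⟦ a ⟧ ⟩
  ⟦ b ℕ.∸ a ⟧ + ⟦ a ⟧ - ⟦ a ⟧      ≡⟨ cong (_- ⟦ a ⟧) (⟦⟧-homo-+ (b ℕ.∸ a) a) ⟨
  ⟦ b ℕ.∸ a ℕ.+ a ⟧ - ⟦ a ⟧        ≡⟨ cong (λ x → ⟦ x ⟧ - ⟦ a ⟧) (ℕ.m∸n+n≡m a≤b) ⟩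
  ⟦ b ⟧ - ⟦ a ⟧                    ∎
  where
  open ≡-Reasoning
  x≡x+y-y : ∀ x y → x ≡ x + y - y
  x≡x+y-y = solve 2 (λ x y → x := x :+ y :- y) refl
    where open +-*-Solver

0≤⟦b⟧-⟦a⟧ : ∀ {a b} → a ≤ b → 0ℚ ℚ.≤ ⟦ b ⟧ - ⟦ a ⟧
0≤⟦b⟧-⟦a⟧ {a} {b} a≤b = subst (0ℚ ℚ.≤_) (⟦⟧-homo-∸ a≤b) (⟦⟧-nonNeg (b ℕ.∸ a))

⟦⟧-mono-≤ : ∀ {a b} → a ≤ b → ⟦ a ⟧ ℚ.≤ ⟦ b ⟧
⟦⟧-mono-≤ {a} {b} a≤b = begin
  ⟦ a ⟧                    ≤⟨ p≤p+q ⟦ a ⟧ (⟦⟧-nonNeg (b ℕ.∸ a)) ⟩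
  ⟦ a ⟧ + ⟦ b ℕ.∸ a ⟧      ≡⟨ ⟦⟧-homo-+ a (b ℕ.∸ a) ⟨
  ⟦ a ℕ.+ (b ℕ.∸ a) ⟧      ≡⟨ cong ⟦_⟧ (ℕ.m+[n∸m]≡n a≤b) ⟩
  ⟦ b ⟧                    ∎
  where open ℚ.≤-Reasoning

m/1*a/[1+c]≃d/1 : ∀ {m a c d} → m ℕ.* a ≡ suc c ℕ.* d →
  ℚᵘ.mkℚᵘ (+ m) 0 ℚᵘ.* ℚᵘ.mkℚᵘ (+ a) c ℚᵘ.≃ ℚᵘ.mkℚᵘ (+ d) 0
m/1*a/[1+c]≃d/1 {m} {a} {c} {d} m*a≡[1+c]*d = ℚᵘ.*≡* (begin
  (+ m ℤ.* + a) ℤ.* + 1          ≡⟨ ℤ.*-identityʳ _ ⟩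
  + m ℤ.* + a                    ≡⟨ ℤ.pos-* m a ⟨
  + (m ℕ.* a)                    ≡⟨ cong +_ (trans m*a≡[1+c]*d (ℕ.*-comm (suc c) d)) ⟩
  + (d ℕ.* suc c)                ≡⟨ cong (λ x → + (d ℕ.* x)) (ℕ.*-identityˡ (suc c)) ⟨
  + (d ℕ.* (1 ℕ.* suc c))        ≡⟨ ℤ.pos-* d (1 ℕ.* suc c) ⟩
  + d ℤ.* + (1 ℕ.* suc c)        ∎)
  where open ≡-Reasoning

⟦m⟧*ratio[a,b]≡⟦d⟧ : ∀ {m a b d} → 0 < b → m ℕ.* a ≡ b ℕ.* d → ⟦ m ⟧ * ratio a b ≡ ⟦ d ⟧
⟦m⟧*ratio[a,b]≡⟦d⟧ {m} {a} {suc c} {d} _ m*a≡b*d = ℚ.toℚᵘ-injective (begin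
  ℚ.toℚᵘ (⟦ m ⟧ * ratio a (suc c))                  ≈⟨ ℚ.toℚᵘ-homo-* ⟦ m ⟧ (ratio a (suc c)) ⟩
  ℚ.toℚᵘ ⟦ m ⟧ ℚᵘ.* ℚ.toℚᵘ (ratio a (suc c))        ≈⟨ ℚᵘ.*-cong (toℚᵘ-⟦⟧ m) (ℚ.toℚᵘ-fromℚᵘ (ℚᵘ.mkℚᵘ (+ a) c)) ⟩
  ℚᵘ.mkℚᵘ (+ m) 0 ℚᵘ.* ℚᵘ.mkℚᵘ (+ a) c              ≈⟨ m/1*a/[1+c]≃d/1 {m} {a} m*a≡b*d ⟩
  ℚᵘ.mkℚᵘ (+ d) 0                                   ≈⟨ toℚᵘ-⟦⟧ d ⟨
  ℚ.toℚᵘ ⟦ d ⟧                                      ∎)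
  where open ℚᵘ.≃-Reasoning

ratio-nonNeg : ∀ a b → 0ℚ ℚ.≤ ratio a b
ratio-nonNeg a zero    = ℚ.≤-refl
ratio-nonNeg a (suc b) = ℚ.nonNegative⁻¹ (ratio a (suc b)) {{ℚ.normalize-nonNeg a (suc b)}}

*-distribˡ-sumTo : ∀ c n f → c * sumTo n f ≡ sumTo n (λ i → c * f i)
*-distribˡ-sumTo c zero    f = refl
*-distribˡ-sumTo c (suc n) f =
  trans (ℚ.*-distribˡ-+ c (sumTo n f) (f (suc n))) (cong (_+ c * f (suc n)) (*-distribˡ-sumTo c n f))

sumTo-monoˡ-≤ : ∀ {j n} f → (∀ i → i ≤ n → 0ℚ ℚ.≤ f i) → j ≤ n → sumTo j f ℚ.≤ sumTo n f
sumTo-monoˡ-≤ {n = zero}  f _   z≤n   = ℚ.≤-refl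
sumTo-monoˡ-≤ {n = suc n} f f≥0 j≤1+n with ℕ.m≤n⇒m<n∨m≡n j≤1+n
... | inj₁ (s≤s j≤n) = ℚ.≤-trans (sumTo-monoˡ-≤ f (λ i i≤n → f≥0 i (ℕ.m≤n⇒m≤1+n i≤n)) j≤n)
                                 (p≤p+q (sumTo n f) (f≥0 (suc n) ℕ.≤-refl))
... | inj₂ refl      = ℚ.≤-refl

f≤maxTo : ∀ {j n} f → j ≤ n → f j ℚ.≤ maxTo n f
f≤maxTo {n = zero}  f z≤n   = ℚ.≤-refl
f≤maxTo {n = suc n} f j≤1+n with ℕ.m≤n⇒m<n∨m≡n j≤1+n
... | inj₁ (s≤s j≤n) = ℚ.≤-trans (f≤maxTo f j≤n) (ℚ.p≤p⊔q (maxTo n f) (f (suc n)))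
... | inj₂ refl      = ℚ.p≤q⊔p (maxTo n f) (f (suc n))

module _ (n S : ℕ) (p : ℕ → ℚ) {i j : ℕ} where

  termIJ-inside : i ≤ j → j < sOf n S i →
    termIJ n S p i j ≡ ratio (ff j i) (ff n i) * p i * (⟦ sOf n S i ⟧ - ⟦ j ⟧)
  termIJ-inside i≤j j<s with i ℕ.≤? j | j ℕ.<? sOf n S i
  ... | yes _   | yes _   = refl
  ... | yes _   | no  j≮s = contradiction j<s j≮s
  ... | no  i≰j | _       = contradiction i≤j i≰j

  termIJ-outside : sOf n S i ≤ j → termIJ n S p i j ≡ 0ℚ
  termIJ-outside s≤j with i ℕ.≤? j | j ℕ.<? sOf n S i
  ... | yes _ | yes j<s = contradiction s≤j (ℕ.<⇒≱ j<s)
  ... | yes _ | no  _   = refl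
  ... | no  _ | _       = refl

  termIJ-nonNeg : 0ℚ ℚ.≤ p i → 0ℚ ℚ.≤ termIJ n S p i j
  termIJ-nonNeg 0≤pᵢ with i ℕ.≤? j | j ℕ.<? sOf n S i
  ... | yes _ | yes j<s = *-nonNeg (*-nonNeg (ratio-nonNeg (ff j i) (ff n i)) 0≤pᵢ) (0≤⟦b⟧-⟦a⟧ (ℕ.<⇒≤ j<s))
  ... | yes _ | no  _   = ℚ.≤-refl
  ... | no  _ | _       = ℚ.≤-refl

module Solution (n S : ℕ) (p : ℕ → ℚ) (p≥0 : ∀ i → i ≤ n → 0ℚ ℚ.≤ p i) where

  t : ℕ → ℕ → ℚ
  t = termIJ n S p

  column : ℕ → ℚ
  column j = sumTo n (λ i → t i j)

  v : ℚ
  v = maxTo n column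

  vᵢ : ℕ → ℚ
  vᵢ i = p i * (⟦ sOf n S i ⟧ - ⟦ i ⟧)

  vᵢⱼ : ℕ → ℕ → ℚ
  vᵢⱼ i j = ⟦ n C j ⟧ * t i j

  t-nonNeg : ∀ j i → i ≤ n → 0ℚ ℚ.≤ t i j
  t-nonNeg j i i≤n = termIJ-nonNeg n S p (p≥0 i i≤n)

  v-nonNeg : 0ℚ ℚ.≤ v
  v-nonNeg = begin
    0ℚ        ≤⟨ t-nonNeg 0 0 z≤n ⟩
    t 0 0     ≤⟨ sumTo-monoˡ-≤ (λ i → t i 0) (t-nonNeg 0) z≤n ⟩
    column 0  ≤⟨ f≤maxTo {n = n} column z≤n ⟩
    v         ∎
    where open ℚ.≤-Reasoning

  vᵢ-nonNeg : ∀ i → i ≤ n → 0ℚ ℚ.≤ vᵢ i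
  vᵢ-nonNeg i i≤n = *-nonNeg (p≥0 i i≤n) (0≤⟦b⟧-⟦a⟧ (i≤sOf n S i≤n))

  vᵢⱼ-nonNeg : ∀ i j → i ≤ j → j ≤ n → 0ℚ ℚ.≤ vᵢⱼ i j
  vᵢⱼ-nonNeg i j i≤j j≤n = *-nonNeg (⟦⟧-nonNeg (n C j)) (t-nonNeg j i (ℕ.≤-trans i≤j j≤n))

  column-bound : ∀ j → j ≤ n → sumTo j (λ i → vᵢⱼ i j) - ⟦ n C j ⟧ * v ℚ.≤ 0ℚ
  column-bound j j≤n = p≤q⇒p-q≤0 (begin
    sumTo j (λ i → ⟦ n C j ⟧ * t i j)   ≡⟨ *-distribˡ-sumTo ⟦ n C j ⟧ j (λ i → t i j) ⟨
    ⟦ n C j ⟧ * sumTo j (λ i → t i j)   ≤⟨ ℚ.*-monoˡ-≤-nonNeg ⟦ n C j ⟧ {{ℚ.nonNegative (⟦⟧-nonNeg (n C j))}}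
                                             (ℚ.≤-trans (sumTo-monoˡ-≤ (λ i → t i j) (t-nonNeg j) j≤n)
                                                        (f≤maxTo {n = n} column j≤n)) ⟩
    ⟦ n C j ⟧ * v                       ∎)
    where open ℚ.≤-Reasoning

  module _ {i j} (i≤j : i ≤ j) (j≤n : j ≤ n) where

    private
      K = ⟦ (n ℕ.∸ i) C (j ℕ.∸ i) ⟧
      N = ⟦ n C j ⟧
      P = p i
      s = ⟦ sOf n S i ⟧

    PairBound : Set
    PairBound = K * vᵢ i - vᵢⱼ i j ℚ.≤ P * K * ⟦ j ℕ.∸ i ⟧

    pair-bound-inside : j < sOf n S i → PairBound
    pair-bound-inside j<s = ℚ.≤-reflexive (begin
      K * (P * (s - ⟦ i ⟧)) - N * t i j                     ≡⟨ cong (λ x → K * (P * (s - ⟦ i ⟧)) - N * x)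
                                                                    (termIJ-inside n S p i≤j j<s) ⟩
      K * (P * (s - ⟦ i ⟧)) - N * (r * P * (s - ⟦ j ⟧))     ≡⟨ cong (λ x → x * (P * (s - ⟦ i ⟧)) - N * (r * P * (s - ⟦ j ⟧))) N*r≡K ⟨
      N * r * (P * (s - ⟦ i ⟧)) - N * (r * P * (s - ⟦ j ⟧)) ≡⟨ cancel-s N r P s ⟦ i ⟧ ⟦ j ⟧ ⟩
      P * (N * r) * (⟦ j ⟧ - ⟦ i ⟧)                        ≡⟨ cong₂ (λ x y → P * x * y) N*r≡K (sym (⟦⟧-homo-∸ i≤j)) ⟩
      P * K * ⟦ j ℕ.∸ i ⟧                                  ∎)
      where
      open ≡-Reasoning
      r = ratio (ff j i) (ff n i)
      N*r≡K : N * r ≡ K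
      N*r≡K = ⟦m⟧*ratio[a,b]≡⟦d⟧ {n C j} {ff j i} (i≤s⇒0<ff[s,i] (ℕ.≤-trans i≤j j≤n)) (nCj*ff[j,i]≡ff[n,i]*[n∸i]C[j∸i] i≤j j≤n)
      cancel-s : ∀ N r P s i j → N * r * (P * (s - i)) - N * (r * P * (s - j)) ≡ P * (N * r) * (j - i)
      cancel-s = solve 6 (λ N r P s i j → N :* r :* (P :* (s :- i)) :- N :* (r :* P :* (s :- j))
                                        := P :* (N :* r) :* (j :- i)) refl
        where open +-*-Solver

    pair-bound-outside : sOf n S i ≤ j → PairBound
    pair-bound-outside s≤j = begin
      K * (P * (s - ⟦ i ⟧)) - N * t i j    ≡⟨ cong (λ x → K * (P * (s - ⟦ i ⟧)) - N * x) (termIJ-outside n S p s≤j) ⟩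
      K * (P * (s - ⟦ i ⟧)) - N * 0ℚ       ≡⟨ drop-zero K N P s ⟦ i ⟧ ⟩
      P * K * (s - ⟦ i ⟧)                  ≤⟨ ℚ.*-monoˡ-≤-nonNeg (P * K) {{ℚ.nonNegative 0≤P*K}}
                                               (ℚ.+-monoˡ-≤ (- ⟦ i ⟧) (⟦⟧-mono-≤ s≤j)) ⟩
      P * K * (⟦ j ⟧ - ⟦ i ⟧)              ≡⟨ cong (P * K *_) (⟦⟧-homo-∸ i≤j) ⟨
      P * K * ⟦ j ℕ.∸ i ⟧                  ∎
      where
      open ℚ.≤-Reasoning
      0≤P*K : 0ℚ ℚ.≤ P * K
      0≤P*K = *-nonNeg (p≥0 i (ℕ.≤-trans i≤j j≤n)) (⟦⟧-nonNeg ((n ℕ.∸ i) C (j ℕ.∸ i)))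
      drop-zero : ∀ K N P s i → K * (P * (s - i)) - N * 0ℚ ≡ P * K * (s - i)
      drop-zero = solve 5 (λ K N P s i → K :* (P :* (s :- i)) :- N :* con 0ℚ := P :* K :* (s :- i)) refl
        where open +-*-Solver

  pair-bound : ∀ i j (i≤j : i ≤ j) (j≤n : j ≤ n) → PairBound i≤j j≤n
  pair-bound i j i≤j j≤n =
    [ pair-bound-inside i≤j j≤n , pair-bound-outside i≤j j≤n ]′ (ℕ.<-≤-connex j (sOf n S i))

theorem3p1 : (n S : ℕ) → 1 ≤ n → 2 ≤ S → (p : ℕ → ℚ) → IsProbDist n p →
    ValGeq n S p
      (sumTo n (λ i → p i * (⟦ sOf n S i ⟧ - ⟦ i ⟧))
       - ⟦ S ⟧ * maxTo n (λ j →
           sumTo n (λ i → termIJ n S p i j)))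
theorem3p1 n S _ _ p (p≥0 , _) =
  v , vᵢ , vᵢⱼ , (v-nonNeg , vᵢ-nonNeg , vᵢⱼ-nonNeg , column-bound , pair-bound) , ℚ.≤-refl
  where open Solution n S p p≥0
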